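{- For every $n\ge1$, the pairs of statistics $(\operatorname{inv}_B,\operatorname{m}_B)$ and $(\operatorname{sor}_B,\ell'_B)$ are equidistributed over $B_n$: \[ \sum_{w\in B_n} q^{\operatorname{inv}_B(w)}t^{\operatorname{m}_B(w)} = \sum_{w\in B_n} q^{\operatorname{sor}_B(w)}t^{\ell'_B(w)}. \] In particular, $\operatorname{sor}_B$ has the same distribution over $B_n$ as $\operatorname{inv}_B$, and $\operatorname{m}_B$ has the same distribution over $B_n$ as $\ell'_B$.
   Context: $B_n$ is the group of signed permutations of $\{\pm1,\ldots,\pm n\}$, $w=w_1\cdots w_n$ with $w_i=w(i)$, product $(uv)(x)=u(v(x))$; $\bar i=-i$. $N(w)=|\{i: w_i<0\}|$. $\operatorname{inv}_B(w) = |\{i<j : w(i)>w(j)\}| + |\{i<j : -w(i)>w(j)\}| + N(w)$ (indices in $\{1,\ldots,n\}$). $\operatorname{m}_B(w)=|\{ i : w_i > |w_j| \text{ for some } j>i\}| + N(w)$. For $i\ne\pm j$, $t_{ij}$ exchanges $i\leftrightarrow j$ and $-i\leftrightarrow -j$; $t_{\bar j j}$ exchanges $j\leftrightarrow -j$. $T^B=\{t_{ij}: 1\le i<j\le n\}\cup\{t_{\bar i j} : 1\le i\le j\le n\}$, and $\ell'_B(w)$ is the minimal number of elements of $T^B$ with product $w$. Every $w$ has a unique factorization $w=t_{i_1j_1}\cdots t_{i_kj_k}$ with $0<j_1<\cdots<j_k$ and $i_s\in\{ -j_s,\ldots,j_s-1\}\setminus\{0\}$, and $\operatorname{sor}_B(w)=\sum_s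 \bigl(j_s-i_s-\chi(i_s<0)\bigr)$. -}

module Defs where

open import Data.Nat using (ℕ; zero; suc; _+_; _∸_; _≤_; _<_)
open import Data.Integer as ℤ using (ℤ; +_; -[1+_]; ∣_∣)
open import Data.Integer.Properties using () renaming (_≟_ to _≟ℤ_; _<?_ to _<?ℤ_)
open import Data.List using (List; []; _∷_; map; foldr; length; upTo)
open import Data.Bool.ListAction using (any)
open import Data.List.Relation.Binary.Permutation.Propositional using (_↭_)
open import Data.Bool using (Bool; true; false; if_then_else_)
open import Data.Product using (Σ; _×_; _,_; ∃)
open import Data.Sum using (_⊎_)
open import Relation.Nullary using (does)
open import Relation.Binary.PropositionalEquality using (_≡_)

-- Signed permutations in window notation: w is the list [w_1, …, w_n]
-- of nonzero integers; w ∈ B_n iff (|w_1|, …, |w_n|) is a permutation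
-- of (1, …, n).  w is extended to {±1,…,±n} by w(-x) = -w(x).

oneTo : ℕ → List ℕ
oneTo n = map suc (upTo n)

InB : ℕ → List ℤ → Set
InB n w = map ∣_∣ w ↭ oneTo n

-- w(k) for a 1-based index k (default 0 out of range; never used on B_n)
nth : List ℤ → ℕ → ℤ
nth []       _       = + 0
nth (x ∷ xs) zero    = x
nth (x ∷ xs) (suc k) = nth xs k

ap : List ℤ → ℤ → ℤ
ap w (+ zero)    = + 0
ap w (+ suc k)   = nth w k
ap w -[1+ k ]    = ℤ.- nth w k

idB : ℕ → List ℤ
idB n = map +_ (oneTo n)

_·_ : List ℤ → List ℤ → List ℤ
u · v = map (ap u) v

-- Reflections.  swp a b exchanges a ↔ b and -a ↔ -b (for a = -b it
-- exchanges b ↔ -b).  t a b is the corresponding element of B_n.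

swp : ℤ → ℤ → ℤ → ℤ
swp a b x =
  if does (x ≟ℤ a) then b else
  if does (x ≟ℤ b) then a else
  if does (x ≟ℤ ℤ.- a) then ℤ.- b else
  if does (x ≟ℤ ℤ.- b) then ℤ.- a else x

t : ℕ → ℤ → ℤ → List ℤ
t n a b = map (λ k → swp a b (+ k)) (oneTo n)

prodT : ℕ → List (ℤ × ℤ) → List ℤ
prodT n = foldr (λ { (a , b) acc → t n a b · acc }) (idB n)

data InTB (n : ℕ) : ℤ × ℤ → Set where
  pos : (i j : ℕ) → 1 ≤ i → i < j → j ≤ n → InTB n (+ i , + j)
  neg : (i j : ℕ) → 1 ≤ i → i ≤ j → j ≤ n → InTB n (ℤ.- (+ i) , + j)

data AllTB (n : ℕ) : List (ℤ × ℤ) → Set where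
  []  : AllTB n []
  _∷_ : ∀ {p ps} → InTB n p → AllTB n ps → AllTB n (p ∷ ps)

IsLB' : ℕ → List ℤ → ℕ → Set
IsLB' n w k =
  (Σ (List (ℤ × ℤ)) λ ts → AllTB n ts × length ts ≡ k × prodT n ts ≡ w)
  × (∀ ts → AllTB n ts → prodT n ts ≡ w → k ≤ length ts)

-- sor_B via the canonical factorization w = t_{i1 j1} ⋯ t_{ik jk},
-- 0 < j1 < ⋯ < jk (≤ n), i_s ∈ {-j_s,…,j_s-1} \ {0}.
-- A factor is stored as (i , j) with i : ℤ, j : ℕ.

data AdmI (j : ℕ) : ℤ → Set where
  posI : (p : ℕ) → 1 ≤ p → p < j → AdmI j (+ p)
  negI : (p : ℕ) → 1 ≤ p → p ≤ j → AdmI j (ℤ.- (+ p))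

data Canon (n : ℕ) : ℕ → List (ℤ × ℕ) → Set where
  []  : ∀ {m} → Canon n m []
  cons : ∀ {m i j fs} → m < j → j ≤ n → AdmI j i → Canon n j fs → Canon n m ((i , j) ∷ fs)

-- weight j - i - χ(i < 0)
wt : ℤ × ℕ → ℕ
wt (+ p , j)     = j ∸ p
wt (-[1+ p ] , j) = j + p

sorSum : List (ℤ × ℕ) → ℕ
sorSum = foldr (λ f acc → wt f + acc) 0

prodC : ℕ → List (ℤ × ℕ) → List ℤ
prodC n = foldr (λ { (i , j) acc → t n i (+ j) · acc }) (idB n)

IsSorB : ℕ → List ℤ → ℕ → Set
IsSorB n w s = Σ (List (ℤ × ℕ)) λ fs → Canon n 0 fs × prodC n fs ≡ w × sorSum fs ≡ s

ind : Bool → ℕ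
ind true  = 1
ind false = 0

lt : ℤ → ℤ → Bool
lt x y = does (x <?ℤ y)

count : (ℤ → Bool) → List ℤ → ℕ
count p []       = 0
count p (y ∷ ys) = ind (p y) + count p ys

-- |{i<j : w_i > w_j}| + |{i<j : -w_i > w_j}| + N(w)
invB : List ℤ → ℕ
invB []       = 0
invB (x ∷ xs) = count (λ y → lt y x) xs + count (λ y → lt y (ℤ.- x)) xs + ind (lt x (+ 0)) + invB xs

-- |{i : w_i > |w_j| for some j > i}| + N(w)
mB : List ℤ → ℕ
mB []       = 0
mB (x ∷ xs) = ind (any (λ y → lt (+ ∣ y ∣) x) xs) + ind (lt x (+ 0)) + mB xs

-- Write w ∈ B_n as a (±n) b with |a| = q and a b ∈ B_(n-1).  The
-- bijection σ sends w to (σ(a b) n) · t_{±(q+1),n}, with no new factor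
-- when w ends in +n; in window notation this is `displace`.  So the
-- canonical factorization of σ(w) is that of σ(a b) followed by at most
-- one factor, whose weight is exactly the number of inversions created by
-- inserting ±n into a b, and which is present exactly when ±n contributes
-- to m_B.  Hence sor_B(σ w) = inv_B(w), and σ(w) is a product of m_B(w)
-- reflections.
--
-- Minimality uses signed labellings F of {1,…,n} with |F(k)| ≤ k that are
-- invariant under v, i.e. F(v(k)) = F(k) for the odd extension of F.  The
-- identity labelling has n fixed points, and a further reflection t_{ab}
-- is absorbed by merging the labels of a and b at the cost of at most one
-- fixed point, so a product of r reflections has an invariant labelling
-- with at least n − r fixed points.  For σ(w), every factor t_{±(q+1),n}
-- forces F(n) ≠ n, so an invariant labelling has at most n − m_B(w) fixed
-- points.  Together, m_B(w) ≤ r.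

module Submission where

open import Defs
open import Data.Nat as ℕ using (ℕ; zero; suc; _+_; _∸_; _≤_; _<_; z≤n; s≤s)
open import Data.Nat.Tactic.RingSolver using (solve-∀)
open import Data.Nat.Properties as ℕP
  using (≤-refl; ≤-trans; <-irrefl; suc-injective; m≤m+n; m≤n⇒m≤1+n; n<1+n)
open import Data.Integer as ℤ using (ℤ; +_; -[1+_]; ∣_∣)
import Data.Integer.Properties as ℤP
open import Data.List using (List; []; _∷_; _++_; _∷ʳ_; [_]; map; length; upTo; applyUpTo; take; drop; break; initLast; _∷ʳ′_)
import Data.List.Properties as ListP
open import Data.List.Relation.Unary.All as All using (All; []; _∷_)
import Data.List.Relation.Unary.All.Properties as AllP
open import Data.List.Membership.Propositional using (_∈_)
open import Data.List.Membership.Propositional.Properties using (∈-map⁻; ∈-map⁺; ∈-upTo⁺; ∈-upTo⁻; ∈-∃++)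
open import Data.List.Relation.Binary.Permutation.Propositional using (_↭_; ↭-refl; ↭-sym; ↭-trans; prep; swap)
import Data.List.Relation.Binary.Permutation.Propositional.Properties as ↭P
open import Data.Product using (Σ; _×_; _,_; proj₁; proj₂)
open import Algebra.Properties.CommutativeSemigroup ℕP.+-commutativeSemigroup using (x∙yz≈y∙xz)
open import Data.Bool using (Bool; true; false)
open import Data.Bool.ListAction using (any)
open import Data.Sum using (inj₁; inj₂)
open import Data.Empty using (⊥-elim)
open import Function using (_∘_; case_of_)
open import Relation.Nullary using (Dec; does; yes; no)
open import Relation.Nullary.Decidable using (dec-true; dec-false)
open import Relation.Binary.PropositionalEquality using (_≡_; _≢_; refl; sym; trans; cong; cong₂; subst; module ≡-Reasoning)

Odd : (ℤ → ℤ) → Set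
Odd h = ∀ z → h (ℤ.- z) ≡ ℤ.- h z

withSignOf : ℤ → ℤ → ℤ
withSignOf (+ _)    y = y
withSignOf -[1+ _ ] y = ℤ.- y

withSignOf-involutive : ∀ s y → withSignOf s (withSignOf s y) ≡ y
withSignOf-involutive (+ _)    y = refl
withSignOf-involutive -[1+ _ ] y = ℤP.neg-involutive y

∣withSignOf∣ : ∀ s y → ∣ withSignOf s y ∣ ≡ ∣ y ∣
∣withSignOf∣ (+ _)    y = refl
∣withSignOf∣ -[1+ _ ] y = ℤP.∣-i∣≡∣i∣ y

withSignOf-∣∣ : ∀ a → withSignOf a (+ ∣ a ∣) ≡ a
withSignOf-∣∣ (+ _)    = refl
withSignOf-∣∣ -[1+ _ ] = refl

withSignOf-withSignOf : ∀ a n y → withSignOf (withSignOf a (+ suc n)) y ≡ withSignOf a y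
withSignOf-withSignOf (+ _)    n y = refl
withSignOf-withSignOf -[1+ _ ] n y = refl

++-injective : ∀ {A : Set} (a₁ a₂ b₁ b₂ : List A) → length a₁ ≡ length a₂ →
               a₁ ++ b₁ ≡ a₂ ++ b₂ → a₁ ≡ a₂ × b₁ ≡ b₂
++-injective []        []        b₁ b₂ _ eq = refl , eq
++-injective (x₁ ∷ a₁) (x₂ ∷ a₂) b₁ b₂ l eq with refl , eq′ ← ListP.∷-injective eq
  with refl , refl ← ++-injective a₁ a₂ b₁ b₂ (suc-injective l) eq′ = refl , refl

length-++-≤ : ∀ {A : Set} (a b : List A) → length a ≤ length (a ++ b)
length-++-≤ a b = subst (length a ≤_) (sym (ListP.length-++ a)) (m≤m+n (length a) (length b))

-- Signed permutations

Bounded : ℕ → ℤ → Set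
Bounded m y = ∣ y ∣ ≤ m

Bounded-neg : ∀ m y → Bounded m y → Bounded m (ℤ.- y)
Bounded-neg m y = subst (_≤ m) (sym (ℤP.∣-i∣≡∣i∣ y))

oneTo-∷ʳ : ∀ m → oneTo m ∷ʳ suc m ≡ oneTo (suc m)
oneTo-∷ʳ m = trans (sym (ListP.map-++ suc (upTo m) [ m ])) (cong (map suc) (ListP.upTo-∷ʳ m))

oneTo-suc : ∀ m → oneTo (suc m) ↭ suc m ∷ oneTo m
oneTo-suc m = subst (_↭ suc m ∷ oneTo m) (oneTo-∷ʳ m) (↭-sym (↭P.∷↭∷ʳ (suc m) (oneTo m)))

length-oneTo : ∀ m → length (oneTo m) ≡ m
length-oneTo m = trans (ListP.length-map suc (upTo m)) (ListP.length-upTo m)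

oneTo-bounded : ∀ m → All (_≤ m) (oneTo m)
oneTo-bounded m = All.tabulate bound
  where
  bound : ∀ {k} → k ∈ oneTo m → k ≤ m
  bound k∈ with j , j∈ , refl ← ∈-map⁻ suc k∈ = ∈-upTo⁻ j∈

InB-length : ∀ m {u} → InB m u → length u ≡ m
InB-length m {u} p = trans (sym (ListP.length-map ∣_∣ u)) (trans (↭P.↭-length p) (length-oneTo m))

InB-bounded : ∀ m {u} → InB m u → All (Bounded m) u
InB-bounded m p = AllP.map⁻ (↭P.All-resp-↭ (↭-sym p) (oneTo-bounded m))

InB-zero : ∀ {u} → InB 0 u → u ≡ []
InB-zero {[]}    _ = refl
InB-zero {_ ∷ _} p with () ← ↭P.↭-empty-inv p

bounded⇒≢suc : ∀ m {u} → All (Bounded m) u → All (λ y → ∣ y ∣ ≢ suc m) u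
bounded⇒≢suc m = All.map λ le eq → <-irrefl refl (subst (_≤ m) eq le)

InB-extend : ∀ m {v u x} → ∣ x ∣ ≡ suc m → map ∣_∣ v ↭ ∣ x ∣ ∷ map ∣_∣ u → InB m u → InB (suc m) v
InB-extend m {x = x} e v↭ p =
  ↭-trans v↭ (subst (λ k → k ∷ _ ↭ _) (sym e) (↭-trans (prep (suc m) p) (↭-sym (oneTo-suc m))))

InB-shrink : ∀ m {v u x} → ∣ x ∣ ≡ suc m → map ∣_∣ v ↭ ∣ x ∣ ∷ map ∣_∣ u → InB (suc m) v → InB m u
InB-shrink m {x = x} e v↭ p =
  ↭P.drop-∷ (subst (λ k → k ∷ _ ↭ _) e (↭-trans (↭-sym v↭) (↭-trans p (oneTo-suc m))))

map∣∣-++-∷ : ∀ a x b → map ∣_∣ (a ++ x ∷ b) ↭ ∣ x ∣ ∷ map ∣_∣ (a ++ b)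
map∣∣-++-∷ a x b rewrite ListP.map-++ ∣_∣ a (x ∷ b) | ListP.map-++ ∣_∣ a b =
  ↭P.shift ∣ x ∣ (map ∣_∣ a) (map ∣_∣ b)

record LargestLetter (m : ℕ) (w : List ℤ) : Set where
  constructor largestLetter
  field
    prefix suffix : List ℤ
    letter        : ℤ
    split         : w ≡ prefix ++ letter ∷ suffix
    ∣letter∣      : ∣ letter ∣ ≡ suc m
    rest          : InB m (prefix ++ suffix)

largestLetterOf : ∀ m {w} → InB (suc m) w → LargestLetter m w
largestLetterOf m p
  with x , x∈w , e ← ∈-map⁻ ∣_∣ (↭P.∈-resp-↭ (↭-sym p) (∈-map⁺ suc (∈-upTo⁺ (n<1+n m))))
  with a , b , refl ← ∈-∃++ x∈w
  = largestLetter a b x refl (sym e) (InB-shrink m {x = x} (sym e) (map∣∣-++-∷ a x b) p)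

-- The bijection σ

displace : ℕ → ℤ → List ℤ → List ℤ
displace zero    x []      = [ x ]
displace zero    x (y ∷ u) = x ∷ (u ∷ʳ withSignOf x y)
displace (suc q) x []      = [ x ]
displace (suc q) x (y ∷ u) = y ∷ displace q x u

σ : ℕ → List ℤ → List ℤ
σ zero    w = w
σ (suc m) w with break (λ y → ∣ y ∣ ℕ.≟ suc m) w
... | a , []    = w  -- does not occur for w ∈ B_(m+1)
... | a , x ∷ b = displace (length a) x (σ m (a ++ b))

break-at : ∀ n a x b → All (λ y → ∣ y ∣ ≢ n) a → ∣ x ∣ ≡ n →
           break (λ y → ∣ y ∣ ℕ.≟ n) (a ++ x ∷ b) ≡ (a , x ∷ b)
break-at n []      x b []        e rewrite dec-true (∣ x ∣ ℕ.≟ n) e = refl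
break-at n (y ∷ a) x b (y≢ ∷ a≢) e rewrite dec-false (∣ y ∣ ℕ.≟ n) y≢ | break-at n a x b a≢ e = refl

σ-suc : ∀ m a x b → InB m (a ++ b) → ∣ x ∣ ≡ suc m →
        σ (suc m) (a ++ x ∷ b) ≡ displace (length a) x (σ m (a ++ b))
σ-suc m a x b p e
  rewrite break-at (suc m) a x b (bounded⇒≢suc m (AllP.++⁻ˡ a (InB-bounded m p))) e = refl

length-displace : ∀ q x u → length (displace q x u) ≡ suc (length u)
length-displace zero    x []      = refl
length-displace zero    x (y ∷ u) = cong suc (trans (ListP.length-++ u) (ℕP.+-comm (length u) 1))
length-displace (suc q) x []      = refl
length-displace (suc q) x (y ∷ u) = cong suc (length-displace q x u)

map∣∣-displace : ∀ q x u → map ∣_∣ (displace q x u) ↭ ∣ x ∣ ∷ map ∣_∣ u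
map∣∣-displace zero    x []      = ↭-refl
map∣∣-displace zero    x (y ∷ u) =
  prep ∣ x ∣ (subst (_↭ ∣ y ∣ ∷ map ∣_∣ u) (sym eq) (↭-sym (↭P.∷↭∷ʳ ∣ y ∣ (map ∣_∣ u))))
  where
  eq : map ∣_∣ (u ∷ʳ withSignOf x y) ≡ map ∣_∣ u ∷ʳ ∣ y ∣
  eq = trans (ListP.map-++ ∣_∣ u _) (cong (λ z → map ∣_∣ u ∷ʳ z) (∣withSignOf∣ x y))
map∣∣-displace (suc q) x []      = ↭-refl
map∣∣-displace (suc q) x (y ∷ u) = ↭-trans (prep ∣ y ∣ (map∣∣-displace q x u)) (swap ∣ y ∣ ∣ x ∣ ↭-refl)

displace-zero-∷ : ∀ x u → Σ (List ℤ) λ r → displace zero x u ≡ x ∷ r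
displace-zero-∷ x []      = [] , refl
displace-zero-∷ x (y ∷ u) = _ , refl

displace-injective : ∀ {n q₁ q₂ x₁ x₂ u₁ u₂} → ∣ x₁ ∣ ≡ n → ∣ x₂ ∣ ≡ n →
  All (λ y → ∣ y ∣ ≢ n) u₁ → All (λ y → ∣ y ∣ ≢ n) u₂ → length u₁ ≡ length u₂ →
  q₁ ≤ length u₁ → q₂ ≤ length u₂ → displace q₁ x₁ u₁ ≡ displace q₂ x₂ u₂ →
  q₁ ≡ q₂ × x₁ ≡ x₂ × u₁ ≡ u₂
displace-injective {q₁ = zero} {zero} {u₁ = []} {[]} _ _ _ _ _ _ _ refl = refl , refl , refl
displace-injective {q₁ = zero} {zero} {x₁} {u₁ = y₁ ∷ u₁} {y₂ ∷ u₂} _ _ _ _ _ _ _ eq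
  with refl , eq′ ← ListP.∷-injective eq
  with refl , eq″ ← ListP.∷ʳ-injective u₁ u₂ eq′
  = refl , refl , cong (_∷ u₁) (trans (sym (withSignOf-involutive x₁ y₁))
                                 (trans (cong (withSignOf x₁) eq″) (withSignOf-involutive x₁ y₂)))
displace-injective {q₁ = zero} {suc _} {x₁} {u₁ = u₁} {_ ∷ _} e₁ _ _ (y≢ ∷ _) _ _ _ eq
  with _ , eq₁ ← displace-zero-∷ x₁ u₁ =
  ⊥-elim (y≢ (trans (cong ∣_∣ (sym (proj₁ (ListP.∷-injective (trans (sym eq₁) eq))))) e₁))
displace-injective {q₁ = suc _} {zero} {x₂ = x₂} {_ ∷ _} {u₂} _ e₂ (y≢ ∷ _) _ _ _ _ eq
  with _ , eq₂ ← displace-zero-∷ x₂ u₂ =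
  ⊥-elim (y≢ (trans (cong ∣_∣ (proj₁ (ListP.∷-injective (trans eq eq₂)))) e₂))
displace-injective {q₁ = suc _} {suc _} {u₁ = _ ∷ _} {_ ∷ _}
                   e₁ e₂ (_ ∷ u₁≢) (_ ∷ u₂≢) l (s≤s q₁≤) (s≤s q₂≤) eq
  with refl , eq′ ← ListP.∷-injective eq
  with refl , refl , refl ← displace-injective e₁ e₂ u₁≢ u₂≢ (suc-injective l) q₁≤ q₂≤ eq′
  = refl , refl , refl

σ-InB : ∀ n {w} → InB n w → InB n (σ n w)
σ-InB zero    p = p
σ-InB (suc m) p with largestLetter a b x refl e p′ ← largestLetterOf m p rewrite σ-suc m a x b p′ e =
  InB-extend m {x = x} e (map∣∣-displace (length a) x (σ m (a ++ b))) (σ-InB m p′)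

length-σ : ∀ n {w} → InB n w → length (σ n w) ≡ n
length-σ n p = InB-length n (σ-InB n p)

σ-injective : ∀ n {w₁ w₂} → InB n w₁ → InB n w₂ → σ n w₁ ≡ σ n w₂ → w₁ ≡ w₂
σ-injective zero    _  _  eq = eq
σ-injective (suc m) p₁ p₂ eq
  with largestLetter a₁ b₁ x₁ refl e₁ p₁′ ← largestLetterOf m p₁
     | largestLetter a₂ b₂ x₂ refl e₂ p₂′ ← largestLetterOf m p₂
  rewrite σ-suc m a₁ x₁ b₁ p₁′ e₁ | σ-suc m a₂ x₂ b₂ p₂′ e₂
  with q-eq , refl , σ-eq ← displace-injective e₁ e₂
         (bounded⇒≢suc m (InB-bounded m (σ-InB m p₁′))) (bounded⇒≢suc m (InB-bounded m (σ-InB m p₂′)))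
         (trans (length-σ m p₁′) (sym (length-σ m p₂′)))
         (subst (length a₁ ≤_) (trans (InB-length m p₁′) (sym (length-σ m p₁′))) (length-++-≤ a₁ b₁))
         (subst (length a₂ ≤_) (trans (InB-length m p₂′) (sym (length-σ m p₂′))) (length-++-≤ a₂ b₂)) eq
  with refl , refl ← ++-injective a₁ a₂ b₁ b₂ q-eq (σ-injective m p₁′ p₂′ σ-eq)
  = refl

displace-end : ∀ a x → displace (length a) x a ≡ a ∷ʳ x
displace-end []      x = refl
displace-end (y ∷ a) x = cong (y ∷_) (displace-end a x)

displace-middle : ∀ a x y u → displace (length a) x (a ++ y ∷ u) ≡ a ++ x ∷ (u ∷ʳ withSignOf x y)
displace-middle []      x y u = refl
displace-middle (z ∷ a) x y u = cong (z ∷_) (displace-middle a x y u)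

displace-surjective : ∀ a x b → Σ (List ℤ) λ u → length a ≤ length u × displace (length a) x u ≡ a ++ x ∷ b
displace-surjective a x b with initLast b
... | []       = a , ≤-refl , displace-end a x
... | c ∷ʳ′ z  = a ++ withSignOf x z ∷ c , length-++-≤ a _ ,
                 trans (displace-middle a x (withSignOf x z) c)
                       (cong (λ y → a ++ x ∷ (c ∷ʳ y)) (withSignOf-involutive x z))

σ-surjective : ∀ n {v} → InB n v → Σ (List ℤ) λ w → InB n w × σ n w ≡ v
σ-surjective zero    {v} p = v , p , refl
σ-surjective (suc m) p
  with largestLetter a b x refl e _ ← largestLetterOf m p
  with u , q≤ , displace-u ← displace-surjective a x b
  with w′ , p′ , σw′ ← σ-surjective m {u}
         (InB-shrink m {x = x} e (subst (λ v → map ∣_∣ v ↭ _) displace-u (map∣∣-displace (length a) x u)) p)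
  = take q w′ ++ x ∷ drop q w′ , InB-extend m {x = x} e (map∣∣-++-∷ _ x _) w′-split , σ-eq
  where
  q = length a
  w′-split : InB m (take q w′ ++ drop q w′)
  w′-split = subst (InB m) (sym (ListP.take++drop≡id q w′)) p′
  length-take : length (take q w′) ≡ q
  length-take = trans (ListP.length-take q w′)
    (ℕP.m≤n⇒m⊓n≡m (subst (q ≤_) (trans (InB-length m (subst (InB m) σw′ (σ-InB m p′)))
                                        (sym (InB-length m p′))) q≤))
  σ-eq : σ (suc m) (take q w′ ++ x ∷ drop q w′) ≡ a ++ x ∷ b
  σ-eq = begin
    σ (suc m) (take q w′ ++ x ∷ drop q w′)               ≡⟨ σ-suc m (take q w′) x (drop q w′) w′-split e ⟩
    displace (length (take q w′)) x (σ m (take q w′ ++ drop q w′))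
      ≡⟨ cong₂ (λ k v → displace k x (σ m v)) length-take (ListP.take++drop≡id q w′) ⟩
    displace q x (σ m w′)                                ≡⟨ cong (displace q x) σw′ ⟩
    displace q x u                                       ≡⟨ displace-u ⟩
    a ++ x ∷ b                                           ∎
    where open ≡-Reasoning

-- inv_B and m_B under insertion of the largest letter

count-middle : ∀ p a x b → count p (a ++ x ∷ b) ≡ ind (p x) + count p (a ++ b)
count-middle p []      x b = refl
count-middle p (y ∷ a) x b rewrite count-middle p a x b = x∙yz≈y∙xz (ind (p y)) (ind (p x)) _

count-all : ∀ p b → All (λ z → p z ≡ true) b → count p b ≡ length b
count-all p [] []               = refl
count-all p (z ∷ b) (pz ∷ pb) rewrite pz = cong suc (count-all p b pb)

count-none : ∀ p b → All (λ z → p z ≡ false) b → count p b ≡ 0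
count-none p [] []              = refl
count-none p (z ∷ b) (pz ∷ pb) rewrite pz = count-none p b pb

any-middle : ∀ (p : ℤ → Bool) a x b → p x ≡ false → any p (a ++ x ∷ b) ≡ any p (a ++ b)
any-middle p []      x b px rewrite px = refl
any-middle p (y ∷ a) x b px rewrite any-middle p a x b px = refl

lt-largest : ∀ m y → Bounded m y → lt (+ suc m) y ≡ false
lt-largest m y y≤m = dec-false (+ suc m ℤ.<? y) λ where
  (ℤ.+<+ m<k) → <-irrefl refl (≤-trans m<k (≤-trans y≤m (ℕP.n≤1+n m)))

lt-below-largest : ∀ m y → Bounded m y → lt y (+ suc m) ≡ true
lt-below-largest m (+ k)     k≤m = dec-true (+ k ℤ.<? + suc m) (ℤ.+<+ (s≤s k≤m))
lt-below-largest m -[1+ k ] _  = dec-true (-[1+ k ] ℤ.<? + suc m) ℤ.-<+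

lt-negLargest : ∀ m y → Bounded m y → lt -[1+ m ] y ≡ true
lt-negLargest m (+ k)     _   = dec-true (-[1+ m ] ℤ.<? + k) ℤ.-<+
lt-negLargest m -[1+ k ] k<m = dec-true (-[1+ m ] ℤ.<? -[1+ k ]) (ℤ.-<- k<m)

lt-below-negLargest : ∀ m y → Bounded m y → lt y -[1+ m ] ≡ false
lt-below-negLargest m y y≤m = dec-false (y ℤ.<? -[1+ m ]) λ where
  (ℤ.-<- m<k) → <-irrefl refl (≤-trans m<k (≤-trans (ℕP.n≤1+n _) y≤m))

-- +(m+1) is inverted with the lb letters after it; -(m+1) is negative, is
-- inverted twice with each of the la letters before it (w_i > x and
-- -w_i > x) and once with each letter after it (-x > w_j).
invB-gain : ℤ → ℕ → ℕ → ℕ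
invB-gain (+ _)    la lb = lb
invB-gain -[1+ _ ] la lb = suc (la + la + lb)

mB-gain : ℤ → List ℤ → ℕ
mB-gain (+ _)    []      = 0
mB-gain (+ _)    (_ ∷ _) = 1
mB-gain -[1+ _ ] _       = 1

invB-insert : ∀ m a x b → All (Bounded m) (a ++ b) → ∣ x ∣ ≡ suc m →
              invB (a ++ x ∷ b) ≡ invB-gain x (length a) (length b) + invB (a ++ b)
invB-insert m [] (+ .(suc m)) b bd refl
  rewrite count-all (λ z → lt z (+ suc m)) b (All.map (λ {z} → lt-below-largest m z) bd)
        | count-none (λ z → lt z -[1+ m ]) b (All.map (λ {z} → lt-below-negLargest m z) bd)
  = cong (_+ invB b) (trans (ℕP.+-identityʳ _) (ℕP.+-identityʳ _))
invB-insert m [] -[1+ .m ] b bd refl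
  rewrite count-all (λ z → lt z (+ suc m)) b (All.map (λ {z} → lt-below-largest m z) bd)
        | count-none (λ z → lt z -[1+ m ]) b (All.map (λ {z} → lt-below-negLargest m z) bd)
  = cong (_+ invB b) (ℕP.+-comm (length b) 1)
invB-insert m (y ∷ a) x b (y≤m ∷ bd) e
  rewrite count-middle (λ z → lt z y) a x b | count-middle (λ z → lt z (ℤ.- y)) a x b
        | invB-insert m a x b bd e = step x e
  where
  A = count (λ z → lt z y) (a ++ b)
  B = count (λ z → lt z (ℤ.- y)) (a ++ b)
  C = ind (lt y (+ 0))
  D = invB (a ++ b)
  step : ∀ x → ∣ x ∣ ≡ suc m →
    ind (lt x y) + A + (ind (lt x (ℤ.- y)) + B) + C + (invB-gain x (length a) (length b) + D)
    ≡ invB-gain x (suc (length a)) (length b) + (A + B + C + D)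
  step (+ .(suc m)) refl rewrite lt-largest m y y≤m | lt-largest m (ℤ.- y) (Bounded-neg m y y≤m) =
    rearrange A B C D (length b)
    where
    rearrange : ∀ A B C D lb → 0 + A + (0 + B) + C + (lb + D) ≡ lb + (A + B + C + D)
    rearrange = solve-∀
  step -[1+ .m ] refl rewrite lt-negLargest m y y≤m | lt-negLargest m (ℤ.- y) (Bounded-neg m y y≤m) =
    rearrange A B C D (length a) (length b)
    where
    rearrange : ∀ A B C D la lb →
      1 + A + (1 + B) + C + (suc (la + la + lb) + D) ≡ suc (suc la + suc la + lb) + (A + B + C + D)
    rearrange = solve-∀

mB-insert : ∀ m a x b → All (Bounded m) (a ++ b) → ∣ x ∣ ≡ suc m →
            mB (a ++ x ∷ b) ≡ mB-gain x b + mB (a ++ b)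
mB-insert m [] (+ .(suc m)) []      _            refl = refl
mB-insert m [] (+ .(suc m)) (z ∷ b) (z≤m ∷ _)    refl rewrite lt-below-largest m (+ ∣ z ∣) z≤m = refl
mB-insert m [] -[1+ .m ]    b       _            refl = cong (λ v → ind v + 1 + mB b) (never b)
  where
  never : ∀ b → any (λ z → lt (+ ∣ z ∣) -[1+ m ]) b ≡ false
  never []      = refl
  never (_ ∷ b) = never b
mB-insert m (y ∷ a) x b (y≤m ∷ bd) e
  rewrite any-middle (λ z → lt (+ ∣ z ∣) y) a x b (subst (λ k → lt (+ k) y ≡ false) (sym e) (lt-largest m y y≤m))
        | mB-insert m a x b bd e =
  x∙yz≈y∙xz (ind (any (λ z → lt (+ ∣ z ∣) y) (a ++ b)) + ind (lt y (+ 0))) (mB-gain x b) (mB (a ++ b))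

-- Products and reflections

nth-applyUpTo : ∀ (g : ℕ → ℤ) n k → k < n → nth (applyUpTo g n) k ≡ g k
nth-applyUpTo g (suc n) zero    _        = refl
nth-applyUpTo g (suc n) (suc k) (s≤s k<) = nth-applyUpTo (g ∘ suc) n k k<

map-oneTo : ∀ (g : ℕ → ℤ) n → map g (oneTo n) ≡ applyUpTo (g ∘ suc) n
map-oneTo g n = trans (sym (ListP.map-∘ (upTo n))) (ListP.map-upTo (g ∘ suc) n)

nth-map-oneTo : ∀ (g : ℕ → ℤ) n k → k < n → nth (map g (oneTo n)) k ≡ g (suc k)
nth-map-oneTo g n k k< = trans (cong (λ l → nth l k) (map-oneTo g n)) (nth-applyUpTo (g ∘ suc) n k k<)

nth-ext : ∀ (u v : List ℤ) → length u ≡ length v → (∀ k → k < length u → nth u k ≡ nth v k) → u ≡ v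
nth-ext []      []      _ _  = refl
nth-ext (x ∷ u) (y ∷ v) l eq =
  cong₂ _∷_ (eq zero (s≤s z≤n)) (nth-ext u v (suc-injective l) (λ k k< → eq (suc k) (s≤s k<)))

nth-∷ʳ : ∀ u (z : ℤ) k → k < length u → nth (u ∷ʳ z) k ≡ nth u k
nth-∷ʳ (x ∷ u) z zero    _        = refl
nth-∷ʳ (x ∷ u) z (suc k) (s≤s k<) = nth-∷ʳ u z k k<

nth-∷ʳ-last : ∀ u (z : ℤ) → nth (u ∷ʳ z) (length u) ≡ z
nth-∷ʳ-last []      z = refl
nth-∷ʳ-last (x ∷ u) z = nth-∷ʳ-last u z

nth-· : ∀ u v k → nth (u · v) k ≡ ap u (nth v k)
nth-· u []      k       = refl
nth-· u (x ∷ v) zero    = refl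
nth-· u (x ∷ v) (suc k) = nth-· u v k

ap-neg : ∀ u y → ap u (ℤ.- y) ≡ ℤ.- ap u y
ap-neg u (+ zero)  = refl
ap-neg u (+ suc k) = refl
ap-neg u -[1+ k ]  = sym (ℤP.neg-involutive (nth u k))

ap-withSignOf : ∀ u s y → ap u (withSignOf s y) ≡ withSignOf s (ap u y)
ap-withSignOf u (+ _)    y = refl
ap-withSignOf u -[1+ _ ] y = ap-neg u y

ap-· : ∀ u v y → ap (u · v) y ≡ ap u (ap v y)
ap-· u v (+ zero)  = refl
ap-· u v (+ suc k) = nth-· u v k
ap-· u v -[1+ k ]  = trans (cong ℤ.-_ (nth-· u v k)) (sym (ap-neg u (nth v k)))

ap-∷ʳ : ∀ u z y → Bounded (length u) y → ap (u ∷ʳ z) y ≡ ap u y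
ap-∷ʳ u z (+ zero)  _  = refl
ap-∷ʳ u z (+ suc k) k< = nth-∷ʳ u z k k<
ap-∷ʳ u z -[1+ k ]  k< = cong ℤ.-_ (nth-∷ʳ u z k k<)

·-assoc : ∀ u v w → (u · v) · w ≡ u · (v · w)
·-assoc u v w = trans (ListP.map-cong (ap-· u v) w) (ListP.map-∘ w)

·-identityʳ : ∀ n u → length u ≡ n → u · idB n ≡ u
·-identityʳ n u refl = trans (sym (ListP.map-∘ (oneTo (length u))))
                             (trans (map-oneTo (λ k → ap u (+ k)) (length u)) (applyUpTo-nth u))
  where
  applyUpTo-nth : ∀ u → applyUpTo (nth u) (length u) ≡ u
  applyUpTo-nth []      = refl
  applyUpTo-nth (x ∷ u) = cong (x ∷_) (applyUpTo-nth u)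

nth-idB : ∀ n k → k < n → nth (idB n) k ≡ + suc k
nth-idB n = nth-map-oneTo (λ k → + k) n

ap-idB : ∀ n y → Bounded n y → ap (idB n) y ≡ y
ap-idB n (+ zero)  _  = refl
ap-idB n (+ suc k) k< = nth-idB n k k<
ap-idB n -[1+ k ]  k< = cong ℤ.-_ (nth-idB n k k<)

·-identityˡ : ∀ n v → All (Bounded n) v → idB n · v ≡ v
·-identityˡ n []      []         = refl
·-identityˡ n (y ∷ v) (y≤ ∷ v≤) = cong₂ _∷_ (ap-idB n y y≤) (·-identityˡ n v v≤)

nth-bounded : ∀ n u k → All (Bounded n) u → Bounded n (nth u k)
nth-bounded n []      k       []       = z≤n
nth-bounded n (x ∷ u) zero    (x≤ ∷ _) = x≤
nth-bounded n (x ∷ u) (suc k) (_ ∷ u≤) = nth-bounded n u k u≤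

ap-bounded : ∀ n u y → All (Bounded n) u → Bounded n (ap u y)
ap-bounded n u (+ zero)  _  = z≤n
ap-bounded n u (+ suc k) u≤ = nth-bounded n u k u≤
ap-bounded n u -[1+ k ]  u≤ = Bounded-neg n (nth u k) (nth-bounded n u k u≤)

·-bounded : ∀ n u v → All (Bounded n) u → All (Bounded n) (u · v)
·-bounded n u v u≤ = AllP.map⁺ (All.tabulate (λ {y} _ → ap-bounded n u y u≤))

idB-bounded : ∀ n → All (Bounded n) (idB n)
idB-bounded n = AllP.map⁺ (oneTo-bounded n)

swp-preserves : ∀ (P : ℤ → Set) → (∀ z → P z → P (ℤ.- z)) → ∀ a b x → P a → P b → P x → P (swp a b x)
swp-preserves P P-neg a b x pa pb px
  with does (x ℤP.≟ a) | does (x ℤP.≟ b) | does (x ℤP.≟ ℤ.- a) | does (x ℤP.≟ ℤ.- b)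
... | true  | _     | _     | _     = pb
... | false | true  | _     | _     = pa
... | false | false | true  | _     = P-neg b pb
... | false | false | false | true  = P-neg a pa
... | false | false | false | false = px

swp-fixes : ∀ a b x → ∣ x ∣ ≢ ∣ a ∣ → ∣ x ∣ ≢ ∣ b ∣ → swp a b x ≡ x
swp-fixes a b x x≢a x≢b
  rewrite dec-false (x ℤP.≟ a) (x≢a ∘ cong ∣_∣) | dec-false (x ℤP.≟ b) (x≢b ∘ cong ∣_∣)
        | dec-false (x ℤP.≟ ℤ.- a) (λ e → x≢a (trans (cong ∣_∣ e) (ℤP.∣-i∣≡∣i∣ a)))
        | dec-false (x ℤP.≟ ℤ.- b) (λ e → x≢b (trans (cong ∣_∣ e) (ℤP.∣-i∣≡∣i∣ b))) = refl

swp-second : ∀ a b → b ≢ a → swp a b b ≡ a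
swp-second a b b≢a rewrite dec-false (b ℤP.≟ a) b≢a | dec-true (b ℤP.≟ b) refl = refl

swp-∣first∣ : ∀ a b → a ≢ b → swp a b (+ ∣ a ∣) ≡ withSignOf a b
swp-∣first∣ (+ p)     b _ rewrite dec-true (+ p ℤP.≟ + p) refl = refl
swp-∣first∣ -[1+ p ] b a≢b with + suc p ℤP.≟ b
... | yes refl = refl
... | no  _    rewrite dec-true (+ suc p ℤP.≟ + suc p) refl = refl

swp-invariant : ∀ Φ → Odd Φ → ∀ a b → Φ a ≡ Φ b → ∀ x → Φ (swp a b x) ≡ Φ x
swp-invariant Φ odd a b e x with x ℤP.≟ a
... | yes refl = sym e
... | no _ with x ℤP.≟ b
...   | yes refl = e
...   | no _ with x ℤP.≟ ℤ.- a
...     | yes refl = trans (odd b) (trans (cong ℤ.-_ (sym e)) (sym (odd a)))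
...     | no _ with x ℤP.≟ ℤ.- b
...       | yes refl = trans (odd a) (trans (cong ℤ.-_ e) (sym (odd b)))
...       | no _ = refl

length-t : ∀ n a b → length (t n a b) ≡ n
length-t n a b = trans (ListP.length-map _ (oneTo n)) (length-oneTo n)

nth-t : ∀ n a b k → k < n → nth (t n a b) k ≡ swp a b (+ suc k)
nth-t n a b = nth-map-oneTo (λ k → swp a b (+ k)) n

t-bounded : ∀ n a b → Bounded n a → Bounded n b → All (Bounded n) (t n a b)
t-bounded n a b a≤ b≤ = AllP.map⁺ (All.map (λ {k} → swp-preserves (Bounded n) (Bounded-neg n) a b (+ k) a≤ b≤)
                                           (oneTo-bounded n))

InTB-bounded : ∀ n {a b} → InTB n (a , b) → Bounded n a × Bounded n b
InTB-bounded n (pos i j _ i<j j≤n) = ℕP.<⇒≤ (ℕP.<-≤-trans i<j j≤n) , j≤n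
InTB-bounded n (neg i j _ i≤j j≤n) = Bounded-neg n (+ i) (≤-trans i≤j j≤n) , j≤n

prodT-bounded : ∀ n {ts} → AllTB n ts → All (Bounded n) (prodT n ts)
prodT-bounded n []                   = idB-bounded n
prodT-bounded n (_∷_ {a , b} ab _) =
  ·-bounded n (t n a b) _ (t-bounded n a b (proj₁ (InTB-bounded n ab)) (proj₂ (InTB-bounded n ab)))

toReflection : ℤ × ℕ → ℤ × ℤ
toReflection (i , j) = (i , + j)

Canon⇒AllTB : ∀ n {m fs} → Canon n m fs → AllTB n (map toReflection fs)
Canon⇒AllTB n []                                   = []
Canon⇒AllTB n (cons _ j≤n (posI p 1≤p p<j) rest) = pos p _ 1≤p p<j j≤n ∷ Canon⇒AllTB n rest
Canon⇒AllTB n (cons _ j≤n (negI p 1≤p p≤j) rest) = neg p _ 1≤p p≤j j≤n ∷ Canon⇒AllTB n rest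

prodT-toReflection : ∀ n fs → prodT n (map toReflection fs) ≡ prodC n fs
prodT-toReflection n []             = refl
prodT-toReflection n ((i , j) ∷ fs) = cong (t n i (+ j) ·_) (prodT-toReflection n fs)

prodC-bounded : ∀ n {m fs} → Canon n m fs → All (Bounded n) (prodC n fs)
prodC-bounded n {fs = fs} c = subst (All (Bounded n)) (prodT-toReflection n fs) (prodT-bounded n (Canon⇒AllTB n c))

-- The canonical factorization of σ w

t-suc : ∀ m i j → ∣ i ∣ ≤ j → j ≤ m → t (suc m) i (+ j) ≡ t m i (+ j) ∷ʳ + suc m
t-suc m i j i≤j j≤m = begin
  map g (oneTo (suc m))           ≡⟨ cong (map g) (sym (oneTo-∷ʳ m)) ⟩
  map g (oneTo m ∷ʳ suc m)        ≡⟨ ListP.map-++ g (oneTo m) [ suc m ] ⟩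
  map g (oneTo m) ∷ʳ g (suc m)
    ≡⟨ cong (map g (oneTo m) ∷ʳ_) (swp-fixes i (+ j) (+ suc m) (beyond (≤-trans i≤j j≤m)) (beyond j≤m)) ⟩
  map g (oneTo m) ∷ʳ + suc m      ∎
  where
  open ≡-Reasoning
  g = λ k → swp i (+ j) (+ k)
  beyond : ∀ {k} → k ≤ m → suc m ≢ k
  beyond k≤m refl = <-irrefl refl k≤m

admissible-bounded : ∀ {j i} → AdmI j i → ∣ i ∣ ≤ j
admissible-bounded (posI p _ p<j)       = ℕP.<⇒≤ p<j
admissible-bounded (negI (suc p) _ p≤j) = p≤j

admissible-≢ : ∀ {j i} → AdmI j i → i ≢ + j
admissible-≢ (posI p _ p<j) refl = <-irrefl refl p<j
admissible-≢ (negI (suc p) _ _) ()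

prodC-suc : ∀ m {lo fs} → Canon m lo fs → prodC (suc m) fs ≡ prodC m fs ∷ʳ + suc m
prodC-suc m [] =
  trans (cong (map (λ k → + k)) (sym (oneTo-∷ʳ m))) (ListP.map-++ (λ k → + k) (oneTo m) [ suc m ])
prodC-suc m (cons {i = i} {j} {fs} _ j≤m adm rest)
  rewrite prodC-suc m rest | t-suc m i j (admissible-bounded adm) j≤m = begin
    T′ · (P ∷ʳ + suc m)          ≡⟨ ListP.map-++ (ap T′) P [ + suc m ] ⟩
    (T′ · P) ∷ʳ ap T′ (+ suc m)  ≡⟨ cong₂ _∷ʳ_ (ListP.map-cong-local (All.map (λ {y} → ap-∷ʳ T (+ suc m) y ∘ fit) P≤))
                                               (trans (cong (nth T′) (sym (length-t m i (+ j))))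
                                                      (nth-∷ʳ-last T (+ suc m))) ⟩
    (T · P) ∷ʳ + suc m           ∎
  where
  open ≡-Reasoning
  T = t m i (+ j)
  T′ = T ∷ʳ + suc m
  P = prodC m fs
  P≤ = prodC-bounded m rest
  fit : ∀ {k} → k ≤ m → k ≤ length T
  fit = subst (_ ≤_) (sym (length-t m i (+ j)))

prodC-∷ʳ : ∀ n fs i j → Bounded n i → j ≤ n → prodC n (fs ∷ʳ (i , j)) ≡ prodC n fs · t n i (+ j)
prodC-∷ʳ n []              i j i≤ j≤ = begin
  t n i (+ j) · idB n    ≡⟨ ·-identityʳ n _ (length-t n i (+ j)) ⟩
  t n i (+ j)            ≡⟨ sym (·-identityˡ n _ (t-bounded n i (+ j) i≤ j≤)) ⟩
  idB n · t n i (+ j)    ∎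
  where open ≡-Reasoning
prodC-∷ʳ n ((i′ , j′) ∷ fs) i j i≤ j≤ =
  trans (cong (t n i′ (+ j′) ·_) (prodC-∷ʳ n fs i j i≤ j≤)) (sym (·-assoc (t n i′ (+ j′)) (prodC n fs) _))

nth-displace-at : ∀ q x u → q ≤ length u → nth (displace q x u) q ≡ x
nth-displace-at zero    x []      _        = refl
nth-displace-at zero    x (y ∷ u) _        = refl
nth-displace-at (suc q) x (y ∷ u) (s≤s q≤) = nth-displace-at q x u q≤

nth-displace-other : ∀ q x u k → k ≢ q → k < length u → nth (displace q x u) k ≡ nth u k
nth-displace-other zero    x (y ∷ u) zero    k≢q _        = ⊥-elim (k≢q refl)
nth-displace-other zero    x (y ∷ u) (suc k) _   (s≤s k<) = nth-∷ʳ u _ k k<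
nth-displace-other (suc q) x (y ∷ u) zero    _   _        = refl
nth-displace-other (suc q) x (y ∷ u) (suc k) k≢q (s≤s k<) = nth-displace-other q x u k (k≢q ∘ cong suc) k<

nth-displace-last : ∀ q x u → q < length u → nth (displace q x u) (length u) ≡ withSignOf x (nth u q)
nth-displace-last zero    x (y ∷ u) _        = nth-∷ʳ-last u (withSignOf x y)
nth-displace-last (suc q) x (y ∷ u) (s≤s q<) = nth-displace-last q x u q<

-- Right multiplication by t_{a,m+1} with |a| = q+1 sends the image of q+1
-- to ±(m+1) and moves the old image of q+1 to position m+1.
∷ʳ-·-t : ∀ {m} q a u → length u ≡ m → ∣ a ∣ ≡ suc q → q ≤ m → a ≢ + suc m →
         (u ∷ʳ + suc m) · t (suc m) a (+ suc m) ≡ displace q (withSignOf a (+ suc m)) u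
∷ʳ-·-t q a u refl ∣a∣ q≤m a≢b =
  nth-ext _ _ (trans (ListP.length-map _ (t (suc m) a b)) (trans (length-t (suc m) a b) (sym (length-displace q x u))))
    λ k k< → trans (nth-· V T k) (trans (cong (ap V) (nth-t (suc m) a b k (fit k<))) (entry k (fit k<)))
  where
  m = length u
  b = + suc m
  x = withSignOf a b
  V = u ∷ʳ b
  T = t (suc m) a b
  fit : ∀ {k} → k < length (V · T) → k < suc m
  fit {k} = subst (k <_) (trans (ListP.length-map _ T) (length-t (suc m) a b))
  a≡ : withSignOf a (+ suc q) ≡ a
  a≡ = subst (λ k → withSignOf a (+ k) ≡ a) ∣a∣ (withSignOf-∣∣ a)
  open ≡-Reasoning
  entry : ∀ k → k < suc m → ap V (swp a b (+ suc k)) ≡ nth (displace q x u) k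
  entry k k< with k ℕ.≟ q
  ... | yes refl = begin
    ap V (swp a b (+ suc k))   ≡⟨ cong (λ z → ap V (swp a b (+ z))) (sym ∣a∣) ⟩
    ap V (swp a b (+ ∣ a ∣))   ≡⟨ cong (ap V) (swp-∣first∣ a b a≢b) ⟩
    ap V x                     ≡⟨ ap-withSignOf V a b ⟩
    withSignOf a (nth V m)     ≡⟨ cong (withSignOf a) (nth-∷ʳ-last u b) ⟩
    x                          ≡⟨ sym (nth-displace-at q x u q≤m) ⟩
    nth (displace q x u) q     ∎
  ... | no k≢q with ℕP.m≤n⇒m<n∨m≡n (ℕP.≤-pred k<)
  ...   | inj₁ k<m = begin
    ap V (swp a b (+ suc k))   ≡⟨ cong (ap V) (swp-fixes a b (+ suc k) (k≢q ∘ suc-injective ∘ (λ e → trans e ∣a∣))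
                                                                       (λ e → <-irrefl (suc-injective e) k<m)) ⟩
    nth V k                    ≡⟨ nth-∷ʳ u b k k<m ⟩
    nth u k                    ≡⟨ sym (nth-displace-other q x u k k≢q k<m) ⟩
    nth (displace q x u) k     ∎
  ...   | inj₂ refl = begin
    ap V (swp a b b)               ≡⟨ cong (ap V) (swp-second a b (a≢b ∘ sym)) ⟩
    ap V a                         ≡⟨ cong (ap V) (sym a≡) ⟩
    ap V (withSignOf a (+ suc q))  ≡⟨ ap-withSignOf V a (+ suc q) ⟩
    withSignOf a (nth V q)         ≡⟨ cong (withSignOf a) (nth-∷ʳ u b q q<m) ⟩
    withSignOf a (nth u q)         ≡⟨ sym (withSignOf-withSignOf a m (nth u q)) ⟩
    withSignOf x (nth u q)         ≡⟨ sym (nth-displace-last q x u q<m) ⟩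
    nth (displace q x u) m         ∎
    where
    q<m : q < m
    q<m = ℕP.≤∧≢⇒< q≤m (k≢q ∘ sym)

length-prodC : ∀ n fs → length (prodC n fs) ≡ n
length-prodC n []            = trans (ListP.length-map (λ k → + k) (oneTo n)) (length-oneTo n)
length-prodC n ((i , j) ∷ fs) = trans (ListP.length-map _ (prodC n fs)) (length-prodC n fs)

Canon-∷ʳ : ∀ m {lo fs i} → Canon m lo fs → lo < suc m → AdmI (suc m) i → Canon (suc m) lo (fs ∷ʳ (i , suc m))
Canon-∷ʳ m []                      lo< adm = cons lo< ≤-refl adm []
Canon-∷ʳ m (cons lo<j j≤m adm′ c) _   adm = cons lo<j (m≤n⇒m≤1+n j≤m) adm′ (Canon-∷ʳ m c (s≤s j≤m) adm)

Canon-weaken : ∀ m {lo fs} → Canon m lo fs → Canon (suc m) lo fs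
Canon-weaken m []                     = []
Canon-weaken m (cons lo<j j≤m adm c) = cons lo<j (m≤n⇒m≤1+n j≤m) adm (Canon-weaken m c)

sorSum-∷ʳ : ∀ fs f → sorSum (fs ∷ʳ f) ≡ wt f + sorSum fs
sorSum-∷ʳ []      f = refl
sorSum-∷ʳ (g ∷ fs) f rewrite sorSum-∷ʳ fs f = x∙yz≈y∙xz (wt g) (wt f) (sorSum fs)

length-∷ʳ : ∀ (fs : List (ℤ × ℕ)) f → length (fs ∷ʳ f) ≡ 1 + length fs
length-∷ʳ fs f = trans (ListP.length-++ fs) (ℕP.+-comm (length fs) 1)

record CanonicalFactorization (n : ℕ) (v : List ℤ) (s l : ℕ) : Set where
  constructor factorization
  field
    factors   : List (ℤ × ℕ)
    canonical : Canon n 0 factors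
    product   : prodC n factors ≡ v
    sor       : sorSum factors ≡ s
    size      : length factors ≡ l

appendFactor : ∀ m q a {v s l} → ∣ a ∣ ≡ suc q → AdmI (suc m) a → CanonicalFactorization m v s l →
  CanonicalFactorization (suc m) (displace q (withSignOf a (+ suc m)) v) (wt (a , suc m) + s) (1 + l)
appendFactor m q a ∣a∣ adm (factorization fs c refl refl refl) =
  factorization (fs ∷ʳ (a , suc m)) (Canon-∷ʳ m c (s≤s z≤n) adm) product (sorSum-∷ʳ fs _) (length-∷ʳ fs _)
  where
  a≤ = admissible-bounded adm
  q≤m : q ≤ m
  q≤m = ℕP.≤-pred (subst (_≤ suc m) ∣a∣ a≤)
  product : prodC (suc m) (fs ∷ʳ (a , suc m)) ≡ displace q (withSignOf a (+ suc m)) (prodC m fs)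
  product = begin
    prodC (suc m) (fs ∷ʳ (a , suc m))                   ≡⟨ prodC-∷ʳ (suc m) fs a (suc m) a≤ ≤-refl ⟩
    prodC (suc m) fs · t (suc m) a (+ suc m)            ≡⟨ cong (_· t (suc m) a (+ suc m)) (prodC-suc m c) ⟩
    (prodC m fs ∷ʳ + suc m) · t (suc m) a (+ suc m)
      ≡⟨ ∷ʳ-·-t q a (prodC m fs) (length-prodC m fs) ∣a∣ q≤m (admissible-≢ adm) ⟩
    displace q (withSignOf a (+ suc m)) (prodC m fs)    ∎
    where open ≡-Reasoning

insertFactor : ∀ m (a : List ℤ) x b {v s l} → ∣ x ∣ ≡ suc m → length a + length b ≡ m → length v ≡ m →
  CanonicalFactorization m v s l →
  CanonicalFactorization (suc m) (displace (length a) x v) (invB-gain x (length a) (length b) + s) (mB-gain x b + l)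
insertFactor m a (+ .(suc m)) [] {v} refl a+b≡m v≡m (factorization fs c p refl refl) =
  factorization fs (Canon-weaken m c) product refl refl
  where
  v≡a : length v ≡ length a
  v≡a = trans v≡m (trans (sym a+b≡m) (ℕP.+-identityʳ _))
  product : prodC (suc m) fs ≡ displace (length a) (+ suc m) v
  product = begin
    prodC (suc m) fs                         ≡⟨ trans (prodC-suc m c) (cong (_∷ʳ + suc m) p) ⟩
    v ∷ʳ + suc m                             ≡⟨ sym (displace-end v (+ suc m)) ⟩
    displace (length v) (+ suc m) v          ≡⟨ cong (λ k → displace k (+ suc m) v) v≡a ⟩
    displace (length a) (+ suc m) v          ∎
    where open ≡-Reasoning
insertFactor m a (+ .(suc m)) (z ∷ b) {v} {s} {l} refl a+b≡m _ F =
  subst (λ g → CanonicalFactorization (suc m) (displace q (+ suc m) v) (g + s) (1 + l)) weight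
    (appendFactor m q (+ suc q) refl (posI (suc q) (s≤s z≤n) (s≤s q<m)) F)
  where
  q = length a
  q<m : q < m
  q<m = subst (q <_) a+b≡m (ℕP.m<m+n q (s≤s z≤n))
  weight : m ∸ q ≡ suc (length b)
  weight = trans (cong (_∸ q) (sym a+b≡m)) (ℕP.m+n∸m≡n q (suc (length b)))
insertFactor m a -[1+ .m ] b {v} {s} {l} refl a+b≡m _ F =
  subst (λ g → CanonicalFactorization (suc m) (displace q -[1+ m ] v) (g + s) (1 + l)) weight
    (appendFactor m q -[1+ q ] refl (negI (suc q) (s≤s z≤n) (s≤s q≤m)) F)
  where
  q = length a
  q≤m : q ≤ m
  q≤m = subst (q ≤_) a+b≡m (m≤m+n q (length b))
  weight : suc m + q ≡ suc (q + q + length b)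
  weight = subst (λ k → suc k + q ≡ suc (q + q + length b)) a+b≡m (rearrange q (length b))
    where
    rearrange : ∀ q lb → suc (q + lb) + q ≡ suc (q + q + lb)
    rearrange = solve-∀

σ-canonical : ∀ n {w} → InB n w → CanonicalFactorization n (σ n w) (invB w) (mB w)
σ-canonical zero p rewrite InB-zero p = factorization [] [] refl refl refl
σ-canonical (suc m) p with largestLetter a b x refl e p′ ← largestLetterOf m p
  rewrite σ-suc m a x b p′ e | invB-insert m a x b (InB-bounded m p′) e | mB-insert m a x b (InB-bounded m p′) e
  = insertFactor m a x b e (trans (sym (ListP.length-++ a)) (InB-length m p′)) (length-σ m p′) (σ-canonical m p′)

-- Invariant labellings and the lower bound for ℓ'_B

extend : (ℕ → ℤ) → ℤ → ℤ
extend F (+ zero)  = + 0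
extend F (+ suc k) = F (suc k)
extend F -[1+ k ]  = ℤ.- F (suc k)

extend-odd : ∀ F → Odd (extend F)
extend-odd F (+ zero)  = refl
extend-odd F (+ suc k) = refl
extend-odd F -[1+ k ]  = sym (ℤP.neg-involutive (F (suc k)))

extend-withSignOf : ∀ F s y → extend F (withSignOf s y) ≡ withSignOf s (extend F y)
extend-withSignOf F (+ _)    y = refl
extend-withSignOf F -[1+ _ ] y = extend-odd F y

extend-∣∣ : ∀ F z → 0 < ∣ z ∣ → extend F z ≡ withSignOf z (F ∣ z ∣)
extend-∣∣ F (+ suc k) _ = refl
extend-∣∣ F -[1+ k ]  _ = refl

extend-∘ : ∀ h → Odd h → h (+ 0) ≡ + 0 → ∀ F z → extend (h ∘ F) z ≡ h (extend F z)
extend-∘ h odd h0 F (+ zero)  = sym h0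
extend-∘ h odd h0 F (+ suc k) = refl
extend-∘ h odd h0 F -[1+ k ]  = sym (odd (F (suc k)))

Subdiagonal : (ℕ → ℤ) → Set
Subdiagonal F = ∀ k → ∣ F k ∣ ≤ k

extend-shrinks : ∀ F → Subdiagonal F → ∀ z → ∣ extend F z ∣ ≤ ∣ z ∣
extend-shrinks F F≤ (+ zero)  = z≤n
extend-shrinks F F≤ (+ suc k) = F≤ (suc k)
extend-shrinks F F≤ -[1+ k ]  = subst (_≤ suc k) (sym (ℤP.∣-i∣≡∣i∣ (F (suc k)))) (F≤ (suc k))

-- F is read as a labelling of {1,…,n} by signed labels; v preserves it
-- when v(k) carries the label of k, up to the sign of v(k).
Invariant : (ℕ → ℤ) → ℕ → List ℤ → Set
Invariant F n v = ∀ k → k < n → extend F (nth v k) ≡ F (suc k)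

record InvariantLabelling (n : ℕ) (v : List ℤ) : Set where
  constructor labelling
  field
    labels      : ℕ → ℤ
    subdiagonal : Subdiagonal labels
    invariant   : Invariant labels n v

isFixed : (ℕ → ℤ) → ℕ → ℕ
isFixed F k = ind (does (F k ℤP.≟ + k))

fixedPoints : (ℕ → ℤ) → ℕ → ℕ
fixedPoints F zero    = 0
fixedPoints F (suc k) = fixedPoints F k + isFixed F (suc k)

isFixed-≤1 : ∀ F k → isFixed F k ≤ 1
isFixed-≤1 F k with does (F k ℤP.≟ + k)
... | true  = ≤-refl
... | false = z≤n

isFixed-mono : ∀ F G k → (F k ≡ + k → G k ≡ + k) → isFixed F k ≤ isFixed G k
isFixed-mono F G k imp with F k ℤP.≟ + k
... | no _  = z≤n
... | yes e rewrite dec-true (G k ℤP.≟ + k) (imp e) = ≤-refl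

isFixed-no : ∀ F k → F k ≢ + k → isFixed F k ≡ 0
isFixed-no F k ≢k rewrite dec-false (F k ℤP.≟ + k) ≢k = refl

fixedPoints-mono : ∀ F G n → (∀ k → k ≤ n → F k ≡ + k → G k ≡ + k) → fixedPoints F n ≤ fixedPoints G n
fixedPoints-mono F G zero    _   = z≤n
fixedPoints-mono F G (suc n) imp =
  ℕP.+-mono-≤ (fixedPoints-mono F G n (λ k k≤n → imp k (m≤n⇒m≤1+n k≤n)))
              (isFixed-mono F G (suc n) (imp (suc n) ≤-refl))

fixedPoints-≤-suc : ∀ F G g n → (∀ k → k ≢ g → F k ≡ + k → G k ≡ + k) → fixedPoints F n ≤ suc (fixedPoints G n)
fixedPoints-≤-suc F G g zero    _   = z≤n
fixedPoints-≤-suc F G g (suc n) imp with suc n ℕ.≟ g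
... | no n≢g = ℕP.+-mono-≤ (fixedPoints-≤-suc F G g n imp) (isFixed-mono F G (suc n) (imp (suc n) n≢g))
... | yes refl = begin
  fixedPoints F n + isFixed F (suc n)
    ≤⟨ ℕP.+-mono-≤ (fixedPoints-mono F G n (λ k k≤n → imp k (λ { refl → <-irrefl refl k≤n })))
                   (isFixed-≤1 F (suc n)) ⟩
  fixedPoints G n + 1                      ≡⟨ ℕP.+-comm (fixedPoints G n) 1 ⟩
  suc (fixedPoints G n)                    ≤⟨ s≤s (m≤m+n _ _) ⟩
  suc (fixedPoints G n + isFixed G (suc n)) ∎
  where open ℕP.≤-Reasoning

fixedPoints-id : ∀ n → fixedPoints (λ k → + k) n ≡ n
fixedPoints-id zero = refl
fixedPoints-id (suc n) rewrite fixedPoints-id n | dec-true (+ suc n ℤP.≟ + suc n) refl = ℕP.+-comm n 1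

record Merging (α β : ℤ) : Set where
  field
    h       : ℤ → ℤ
    odd     : Odd h
    merges  : h α ≡ h β
    shrinks : ∀ z → ∣ h z ∣ ≤ ∣ z ∣
    moved   : ℕ
    fixes   : ∀ k → k ≢ moved → h (+ k) ≡ + k

  h-zero : h (+ 0) ≡ + 0
  h-zero = ℤP.∣i∣≡0⇒i≡0 (ℕP.n≤0⇒n≡0 (shrinks (+ 0)))

merging-sym : ∀ {α β} → Merging α β → Merging β α
merging-sym M = record { Merging M ; merges = sym (Merging.merges M) }

-- For |β| ≤ |α| only the labels ±|α| are changed: they become ±β (with the
-- sign arranged so that α ↦ β), or 0 when β = ±α.
merging-≤ : ∀ α β → ∣ β ∣ ≤ ∣ α ∣ → Merging α β
merging-≤ α β β≤α = record
  { h = extend H ; odd = extend-odd H ; merges = merges ; shrinks = extend-shrinks H H≤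
  ; moved = ∣ α ∣ ; fixes = fixes }
  where
  target : Dec (∣ β ∣ < ∣ α ∣) → ℤ
  target (yes _) = withSignOf α β
  target (no _)  = + 0
  relabel : ∀ k → Dec (k ≡ ∣ α ∣) → ℤ
  relabel k (yes _) = target (∣ β ∣ ℕ.<? ∣ α ∣)
  relabel k (no _)  = + k
  H : ℕ → ℤ
  H k = relabel k (k ℕ.≟ ∣ α ∣)
  H-∣α∣ : H ∣ α ∣ ≡ target (∣ β ∣ ℕ.<? ∣ α ∣)
  H-∣α∣ with ∣ α ∣ ℕ.≟ ∣ α ∣
  ... | yes _ = refl
  ... | no ≢  = ⊥-elim (≢ refl)
  H-other : ∀ k → k ≢ ∣ α ∣ → H k ≡ + k
  H-other k k≢ with k ℕ.≟ ∣ α ∣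
  ... | yes ≡ = ⊥-elim (k≢ ≡)
  ... | no _  = refl
  target≤ : ∀ d → ∣ target d ∣ ≤ ∣ α ∣
  target≤ (yes β<α) = subst (_≤ ∣ α ∣) (sym (∣withSignOf∣ α β)) (ℕP.<⇒≤ β<α)
  target≤ (no _)    = z≤n
  H≤ : Subdiagonal H
  H≤ k with k ℕ.≟ ∣ α ∣
  ... | yes refl = target≤ (∣ β ∣ ℕ.<? ∣ α ∣)
  ... | no _     = ≤-refl
  fixes : ∀ k → k ≢ ∣ α ∣ → extend H (+ k) ≡ + k
  fixes zero    _  = refl
  fixes (suc k) k≢ = H-other (suc k) k≢
  merges : extend H α ≡ extend H β
  merges with ∣ β ∣ ℕ.<? ∣ α ∣ in eq
  ... | yes β<α = begin
    extend H α                     ≡⟨ extend-∣∣ H α (ℕP.≤-<-trans z≤n β<α) ⟩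
    withSignOf α (H ∣ α ∣)         ≡⟨ cong (withSignOf α) (trans H-∣α∣ (cong target eq)) ⟩
    withSignOf α (withSignOf α β)  ≡⟨ withSignOf-involutive α β ⟩
    β                              ≡⟨ sym (extend-fixes β (λ e → <-irrefl e β<α)) ⟩
    extend H β                     ∎
    where
    open ≡-Reasoning
    extend-fixes : ∀ z → ∣ z ∣ ≢ ∣ α ∣ → extend H z ≡ z
    extend-fixes (+ k)     k≢ = fixes k k≢
    extend-fixes -[1+ k ] k≢ = cong ℤ.-_ (H-other (suc k) k≢)
  ... | no β≮α = trans (vanishes α refl) (sym (vanishes β (ℕP.≤-antisym β≤α (ℕP.≮⇒≥ β≮α))))
    where
    H-∣α∣≡0 : H ∣ α ∣ ≡ + 0
    H-∣α∣≡0 = trans H-∣α∣ (cong target eq)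
    vanishes : ∀ z → ∣ z ∣ ≡ ∣ α ∣ → extend H z ≡ + 0
    vanishes (+ zero)  _ = refl
    vanishes (+ suc k) e = trans (cong H e) H-∣α∣≡0
    vanishes -[1+ k ]  e = cong ℤ.-_ (trans (cong H e) H-∣α∣≡0)

merging : ∀ α β → Merging α β
merging α β with ℕP.≤-total ∣ β ∣ ∣ α ∣
... | inj₁ β≤α = merging-≤ α β β≤α
... | inj₂ α≤β = merging-sym (merging-≤ β α α≤β)

ap-t-invariant : ∀ n a b Φ → Odd Φ → Φ a ≡ Φ b → ∀ y → Bounded n y → Φ (ap (t n a b) y) ≡ Φ y
ap-t-invariant n a b Φ odd e (+ zero)  _  = refl
ap-t-invariant n a b Φ odd e (+ suc k) k< = trans (cong Φ (nth-t n a b k k<)) (swp-invariant Φ odd a b e (+ suc k))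
ap-t-invariant n a b Φ odd e -[1+ k ]  k< = begin
  Φ (ℤ.- nth (t n a b) k)      ≡⟨ odd (nth (t n a b) k) ⟩
  ℤ.- Φ (nth (t n a b) k)      ≡⟨ cong ℤ.-_ (ap-t-invariant n a b Φ odd e (+ suc k) k<) ⟩
  ℤ.- Φ (+ suc k)              ≡⟨ sym (odd (+ suc k)) ⟩
  Φ -[1+ k ]                   ∎
  where open ≡-Reasoning

-- G merges the labels of a and b, which makes it invariant under t_{ab}.
labelling-· : ∀ n {a b P} → InTB n (a , b) → All (Bounded n) P → (L : InvariantLabelling n P) →
  Σ (InvariantLabelling n (t n a b · P)) λ L′ →
    fixedPoints (InvariantLabelling.labels L) n ≤ suc (fixedPoints (InvariantLabelling.labels L′) n)
labelling-· n {a} {b} {P} ab P≤ (labelling F F≤ F-inv) =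
  labelling G G≤ G-inv , fixedPoints-≤-suc F G moved n (λ k k≢ e → trans (cong h e) (fixes k k≢))
  where
  open Merging (merging (extend F a) (extend F b))
  G : ℕ → ℤ
  G = h ∘ F
  G≤ : Subdiagonal G
  G≤ k = ≤-trans (shrinks (F k)) (F≤ k)
  extend-G : ∀ z → extend G z ≡ h (extend F z)
  extend-G = extend-∘ h odd h-zero F
  G-ab : extend G a ≡ extend G b
  G-ab = trans (extend-G a) (trans merges (sym (extend-G b)))
  G-inv : Invariant G n (t n a b · P)
  G-inv k k< = begin
    extend G (nth (t n a b · P) k)      ≡⟨ cong (extend G) (nth-· (t n a b) P k) ⟩
    extend G (ap (t n a b) (nth P k))
      ≡⟨ ap-t-invariant n a b (extend G) (extend-odd G) G-ab (nth P k) (nth-bounded n P k P≤) ⟩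
    extend G (nth P k)                  ≡⟨ extend-G (nth P k) ⟩
    h (extend F (nth P k))              ≡⟨ cong h (F-inv k k<) ⟩
    G (suc k)                           ∎
    where open ≡-Reasoning

prodT-labelling : ∀ n {ts} → AllTB n ts →
  Σ (InvariantLabelling n (prodT n ts)) λ L → n ≤ fixedPoints (InvariantLabelling.labels L) n + length ts
prodT-labelling n [] =
  labelling (λ k → + k) (λ _ → ≤-refl) (λ k k< → cong (extend (λ k → + k)) (nth-idB n k k<)) ,
  ℕP.≤-reflexive (sym (trans (ℕP.+-identityʳ _) (fixedPoints-id n)))
prodT-labelling n {ts = _ ∷ ts} (ab ∷ ts∈)
  with L , n≤ ← prodT-labelling n ts∈
  with L′ , L≤ ← labelling-· n ab (prodT-bounded n ts∈) L
  = L′ , ≤-trans n≤ (≤-trans (ℕP.+-monoˡ-≤ (length ts) L≤)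
                             (ℕP.≤-reflexive (sym (ℕP.+-suc _ (length ts)))))

module _ {m q x u} (F : ℕ → ℤ) (∣x∣ : ∣ x ∣ ≡ suc m) (u≡m : length u ≡ m) (q≤m : q ≤ m)
         (inv : Invariant F (suc m) (displace q x u)) where

  letter-label : withSignOf x (F (suc m)) ≡ F (suc q)
  letter-label = begin
    withSignOf x (F (suc m))            ≡⟨ cong (λ k → withSignOf x (F k)) (sym ∣x∣) ⟩
    withSignOf x (F ∣ x ∣)              ≡⟨ sym (extend-∣∣ F x (subst (0 <_) (sym ∣x∣) (s≤s z≤n))) ⟩
    extend F x                          ≡⟨ cong (extend F) (sym (nth-displace-at q x u (subst (q ≤_) (sym u≡m) q≤m))) ⟩
    extend F (nth (displace q x u) q)   ≡⟨ inv q (s≤s q≤m) ⟩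
    F (suc q)                           ∎
    where open ≡-Reasoning

  displace-invariant : Invariant F m u
  displace-invariant k k<m with k ℕ.≟ q
  ... | no k≢q = trans (cong (extend F) (sym (nth-displace-other q x u k k≢q k<u))) (inv k (m≤n⇒m≤1+n k<m))
    where k<u = subst (k <_) (sym u≡m) k<m
  ... | yes refl = begin
    extend F (nth u q)                                ≡⟨ sym (withSignOf-involutive x _) ⟩
    withSignOf x (withSignOf x (extend F (nth u q)))  ≡⟨ cong (withSignOf x) (sym (extend-withSignOf F x (nth u q))) ⟩
    withSignOf x (extend F (withSignOf x (nth u q)))  ≡⟨ cong (withSignOf x ∘ extend F) (sym (nth-displace-last q x u q<u)) ⟩
    withSignOf x (extend F (nth (displace q x u) m′)) ≡⟨ cong (withSignOf x) (inv m′ (s≤s (ℕP.≤-reflexive u≡m))) ⟩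
    withSignOf x (F (suc m′))                         ≡⟨ cong (λ k → withSignOf x (F (suc k))) u≡m ⟩
    withSignOf x (F (suc m))                          ≡⟨ letter-label ⟩
    F (suc q)                                         ∎
    where
    open ≡-Reasoning
    m′ = length u
    q<u = subst (q <_) (sym u≡m) k<m

isFixed+1≤1 : ∀ F k → F k ≢ + k → isFixed F k + 1 ≤ 1
isFixed+1≤1 F k ≢k = subst (λ i → i + 1 ≤ 1) (sym (isFixed-no F k ≢k)) ≤-refl

-- The label of ±(m+1) is (up to sign) that of q+1, hence of absolute value
-- at most q+1.
notFixed-below : ∀ F {m q} x → Subdiagonal F → q < m → withSignOf x (F (suc m)) ≡ F (suc q) →
                 F (suc m) ≢ + suc m
notFixed-below F {m} {q} x F≤ q<m F-eq e = <-irrefl refl (≤-trans (s≤s q<m) (subst (_≤ suc q) ∣F∣ (F≤ (suc q))))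
  where
  ∣F∣ : ∣ F (suc q) ∣ ≡ suc m
  ∣F∣ = trans (cong ∣_∣ (sym F-eq)) (trans (∣withSignOf∣ x _) (cong ∣_∣ e))

isFixed-gain : ∀ F {m q} x b → Subdiagonal F → ∣ x ∣ ≡ suc m → q + length b ≡ m →
               withSignOf x (F (suc m)) ≡ F (suc q) → isFixed F (suc m) + mB-gain x b ≤ 1
isFixed-gain F {m} (+ .(suc m)) [] _ refl _ _ = subst (_≤ 1) (sym (ℕP.+-identityʳ _)) (isFixed-≤1 F (suc m))
isFixed-gain F {m} {q} (+ .(suc m)) (_ ∷ b) F≤ refl q+b≡m F-eq =
  isFixed+1≤1 F (suc m) (notFixed-below F (+ suc m) F≤ (subst (q <_) q+b≡m (ℕP.m<m+n q (s≤s z≤n))) F-eq)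
isFixed-gain F {m} {q} -[1+ .m ] b F≤ refl q+b≡m F-eq
  with ℕP.m≤n⇒m<n∨m≡n (subst (q ≤_) q+b≡m (m≤m+n q (length b)))
... | inj₁ q<m  = isFixed+1≤1 F (suc m) (notFixed-below F -[1+ m ] F≤ q<m F-eq)
... | inj₂ refl = isFixed+1≤1 F (suc m) λ e → case trans (cong ℤ.-_ (sym e)) (trans F-eq e) of λ ()

σ-fixedPoints : ∀ n {w} → InB n w → (L : InvariantLabelling n (σ n w)) →
                fixedPoints (InvariantLabelling.labels L) n + mB w ≤ n
σ-fixedPoints zero    p _ rewrite InB-zero p = z≤n
σ-fixedPoints (suc m) p (labelling F F≤ inv)
  with largestLetter a b x refl e p′ ← largestLetterOf m p
  rewrite σ-suc m a x b p′ e | mB-insert m a x b (InB-bounded m p′) e = begin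
    fixedPoints F m + isFixed F (suc m) + (mB-gain x b + mB (a ++ b))  ≡⟨ rearrange (fixedPoints F m) _ _ _ ⟩
    (fixedPoints F m + mB (a ++ b)) + (isFixed F (suc m) + mB-gain x b) ≤⟨ ℕP.+-mono-≤ IH gain ⟩
    m + 1                                                              ≡⟨ ℕP.+-comm m 1 ⟩
    suc m                                                              ∎
  where
  open ℕP.≤-Reasoning
  q≤m : length a ≤ m
  q≤m = subst (length a ≤_) (InB-length m p′) (length-++-≤ a b)
  a+b≡m : length a + length b ≡ m
  a+b≡m = trans (sym (ListP.length-++ a)) (InB-length m p′)
  IH = σ-fixedPoints m p′ (labelling F F≤ (displace-invariant F e (length-σ m p′) q≤m inv))
  gain = isFixed-gain F x b F≤ e a+b≡m (letter-label F e (length-σ m p′) q≤m inv)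
  rearrange : ∀ R I G M → R + I + (G + M) ≡ (R + M) + (I + G)
  rearrange = solve-∀

σ-sorB : ∀ n {w} → InB n w → IsSorB n (σ n w) (invB w)
σ-sorB n p = factors , canonical , product , sor
  where open CanonicalFactorization (σ-canonical n p)

mB≤reflectionLength : ∀ n {w ts} → InB n w → AllTB n ts → prodT n ts ≡ σ n w → mB w ≤ length ts
mB≤reflectionLength n p ts∈ ts≡ with labelling F F≤ F-inv , n≤ ← prodT-labelling n ts∈ =
  ℕP.+-cancelˡ-≤ (fixedPoints F n) _ _
    (≤-trans (σ-fixedPoints n p (labelling F F≤ (subst (Invariant F n) ts≡ F-inv))) n≤)

σ-LB' : ∀ n {w} → InB n w → IsLB' n (σ n w) (mB w)
σ-LB' n p =
  (map toReflection factors , Canon⇒AllTB n canonical ,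
   trans (ListP.length-map toReflection factors) size , trans (prodT-toReflection n factors) product) ,
  λ ts ts∈ ts≡ → mB≤reflectionLength n p ts∈ ts≡
  where open CanonicalFactorization (σ-canonical n p)

corollary3p5 : (n : ℕ) → 1 ≤ n →
    Σ (List ℤ → List ℤ) λ σ →
      (∀ w → InB n w → InB n (σ w))
      × (∀ w w′ → InB n w → InB n w′ → σ w ≡ σ w′ → w ≡ w′)
      × (∀ w′ → InB n w′ → Σ (List ℤ) λ w → InB n w × σ w ≡ w′)
      × (∀ w → InB n w → IsSorB n (σ w) (invB w) × IsLB' n (σ w) (mB w))
corollary3p5 n _ =
  σ n , (λ _ → σ-InB n) , (λ _ _ → σ-injective n) , (λ _ → σ-surjective n) , λ _ p → σ-sorB n p , σ-LB' n p
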